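{- Let $t_1,t_2,\dots$ be indeterminates and for $0\le k\le n$ let $A_{n,k}(\mathbf{t})$ be as defined in the context. Then, as formal power series, \[ \sum_{n,k\geq 0}A_{n+k,k}(\mathbf{t})\frac{x^n}{n!}\frac{y^k}{k!}=t_1e^{ -xt_1}\,\mathcal{Y}(\mathbf{t};x+y), \qquad\text{where }\ \mathcal{Y}(\mathbf{t};z)=\exp\Bigl(\sum_{j\geq1}t_j\frac{z^j}{j!}\Bigr). \]
   Context: For a set partition $\pi$ of a finite set into blocks, assign to each block of size $j$ the weight $t_j$, and let the weight $w(\pi)$ be the product of the weights of its blocks. For $n\ge0$ let $\mathcal{Y}_n(\mathbf{t})=\mathcal{Y}_n(t_1,t_2,\dots)$ be the sum of $w(\pi)$ over all partitions $\pi$ of $[n]=\{1,\dots,n\}$ (with $\mathcal{Y}_0=1$); this is the complete Bell polynomial, with $\sum_{n\ge0}\mathcal{Y}_n(\mathbf{t})z^n/n!=\exp(\sum_{j\ge1}t_jz^j/j!)$. For integers $0\le k\le n$, $A_{n,k}(\mathbf{t})$ is the sum of $w(\pi)$ over all partitions $\pi$ of $[n+1]$ in which $\{k+1\}$ is a block and no $\{i\}$ with $i>k+1$ is a block (i.e. the largest singleton block is $\{k+1\}$). -}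

module Defs where

open import Level using (Level)
open import Data.Nat using (ℕ; zero; suc; _≤ᵇ_; _≡ᵇ_) renaming (_+_ to _+ℕ_; _∸_ to _∸ℕ_)
open import Data.Nat.Combinatorics using (_C_)
open import Data.Bool using (Bool; true; false; _∧_; _∨_)
open import Data.List using (List; []; _∷_; [_]; map; concatMap; foldr; length; upTo)
open import Algebra.Bundles using (CommutativeRing)

-- Set partitions of [n] = {1,…,n}, as lists of blocks (lists of elements).
-- `partitions n` enumerates every set partition of [n] exactly once, by the
-- standard recursion: a partition of [n+1] is obtained from a partition of
-- [n] either by adding the new block {n+1} or by inserting n+1 into one of
-- the existing blocks.

Block : Set
Block = List ℕ

Partition : Set
Partition = List Block

insertEach : ℕ → Partition → List Partition
insertEach m []      = []
insertEach m (b ∷ p) = ((m ∷ b) ∷ p) ∷ map (b ∷_) (insertEach m p)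

partitions : ℕ → List Partition
partitions zero    = [] ∷ []
partitions (suc n) =
  concatMap (λ p → ([ suc n ] ∷ p) ∷ insertEach (suc n) p) (partitions n)

singletons : Partition → List ℕ
singletons []                  = []
singletons ((x ∷ []) ∷ p)      = x ∷ singletons p
singletons (_ ∷ p)             = singletons p

anyB : (ℕ → Bool) → List ℕ → Bool
anyB f = foldr (λ x b → f x ∨ b) false

allB : (ℕ → Bool) → List ℕ → Bool
allB f = foldr (λ x b → f x ∧ b) true

largestSingletonIs : ℕ → Partition → Bool
largestSingletonIs m p = anyB (_≡ᵇ m) (singletons p) ∧ allB (_≤ᵇ m) (singletons p)

filterB : {A : Set} → (A → Bool) → List A → List A
filterB f []       = []
filterB f (x ∷ xs) with f x
... | true  = x ∷ filterB f xs
... | false = filterB f xs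

-- Weights, Bell polynomials and A_{n,k} in an arbitrary commutative ring
-- (the weights t j, j ≥ 1, play the role of the indeterminates t_j;
--  t 0 is never used since blocks are nonempty).

module Ring {c ℓ : Level} (R : CommutativeRing c ℓ) where
  open CommutativeRing R

  _·ℕ_ : ℕ → Carrier → Carrier
  zero  ·ℕ x = 0#
  suc n ·ℕ x = x + (n ·ℕ x)

  _^ℕ_ : Carrier → ℕ → Carrier
  x ^ℕ zero  = 1#
  x ^ℕ suc n = x * (x ^ℕ n)

  sumR : List Carrier → Carrier
  sumR = foldr _+_ 0#

  Σ≤ : ℕ → (ℕ → Carrier) → Carrier
  Σ≤ n f = sumR (map f (upTo (suc n)))

  weight : (ℕ → Carrier) → Partition → Carrier
  weight t = foldr (λ b acc → t (length b) * acc) 1#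

  Y : (ℕ → Carrier) → ℕ → Carrier
  Y t n = sumR (map (weight t) (partitions n))

  A : (ℕ → Carrier) → ℕ → ℕ → Carrier
  A t n k = sumR (map (weight t) (filterB (largestSingletonIs (suc k)) (partitions (suc n))))

  -- Bivariate formal power series in x, y, represented by their
  -- exponential coefficients: f represents  Σ_{n,k} f n k x^n/n! y^k/k!.
  EGF2 : Set c
  EGF2 = ℕ → ℕ → Carrier

  _⋆_ : EGF2 → EGF2 → EGF2
  (f ⋆ g) n k = Σ≤ n (λ a → Σ≤ k (λ b →
                  (n C a) ·ℕ ((k C b) ·ℕ (f a b * g (n ∸ℕ a) (k ∸ℕ b)))))

  _•_ : Carrier → EGF2 → EGF2
  (s • f) n k = s * f n k

  -- e^{-x t₁} = Σ_a (-t₁)^a x^a / a!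
  expNegXt1 : (ℕ → Carrier) → EGF2
  expNegXt1 t a zero    = (- t 1) ^ℕ a
  expNegXt1 t a (suc _) = 0#

  -- 𝒴(t; x+y) = Σ_m Y_m (x+y)^m/m! = Σ_{n,k} Y_{n+k} x^n/n! y^k/k!
  Yxy : (ℕ → Carrier) → EGF2
  Yxy t n k = Y t (n +ℕ k)

  lhsA : (ℕ → Carrier) → EGF2
  lhsA t n k = A t (n +ℕ k) k

  rhsA : (ℕ → Carrier) → EGF2
  rhsA t = t 1 • (expNegXt1 t ⋆ Yxy t)

module Submission where

-- Fix a threshold s.  In a partition of [N] (N ≥ s) call a singleton block
-- {i} *marked* when i > s; the *shape* of the partition is the list of its
-- block types (marked singleton, or plain block of a given size).  Giving
-- marked singletons the weight μ and plain blocks of size j the weight t_j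
-- defines a weight W_μ on shapes.  A partition of [N+1] arises from one of
-- [N] either by adding the marked singleton {N+1} or by inserting N+1 into an
-- existing block; on shapes this is the extension operator E, so the sum of
-- any function of the shape over the partitions of [n+s] is the sum of
-- Eⁿ (applied to that function) over the partitions of [s].
--
-- If μ = t₁ + δ, every marked singleton either behaves as a plain singleton
-- or contributes the factor δ, which yields the binomial transform
--   Eⁿ_marked W_μ = Σ_a C(n,a) δ^a E^{n-a}_plain W_μ.
-- For μ = t₁ (δ = 0) this expresses Y_{j+s}; for μ = 0 (δ = -t₁) it shows
-- that the partitions of [n+s] with no singleton above s have total weight
--   P_s(n) = Σ_a C(n,a) (-t₁)^a Y_{n-a+s}.
-- Finally A_{n+k,k} = P_{k+1}(n) - P_k(n+1), which Pascal's rule turns into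
-- t₁ Σ_a C(n,a) (-t₁)^a Y_{n-a+k}, the coefficient of x^n y^k /(n! k!) in
-- t₁ e^{-x t₁} 𝒴(t; x+y).

open import Defs
open import Level using (Level)
open import Function.Bundles using (Equivalence)
open import Data.Nat using (ℕ; zero; suc; _≤_; _<_; _≤ᵇ_; _≡ᵇ_; z≤n; s≤s)
  renaming (_+_ to _+ℕ_; _∸_ to _∸ℕ_)
open import Data.Nat.Properties using (≤⇒≤ᵇ; m≤n⇒m≤1+n; +-suc; +-∸-assoc; m≤n+m; ≤-refl)
open import Data.Nat.Combinatorics using (_C_; nCk+nC[k+1]≡[n+1]C[k+1]; k>n⇒nCk≡0)
open import Data.Bool using (Bool; true; false; _∧_; _∨_; not; if_then_else_)
open import Data.Bool.Properties using (T-≡)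
open import Data.List using (List; []; _∷_; [_]; map; concatMap; length; applyUpTo; _++_)
open import Data.List.Properties using (map-cong)
open import Data.List.Relation.Unary.All using (All; []; _∷_) renaming (map to All-map)
open import Data.List.Relation.Unary.All.Properties using (map⁺; concat⁺)
open import Data.Maybe using (nothing)
import Relation.Binary.PropositionalEquality as P
open P using (_≡_)
open import Algebra.Bundles using (CommutativeRing)
open import Tactic.RingSolver.Core.AlmostCommutativeRing using (fromCommutativeRing)

below-threshold : ∀ {x s} → x ≤ s → (x ≤ᵇ s) ≡ true
below-threshold x≤s = Equivalence.to T-≡ (≤⇒≤ᵇ x≤s)

above-threshold : ∀ {s N} → s ≤ N → (suc N ≤ᵇ s) ≡ false
above-threshold z≤n     = P.refl
above-threshold (s≤s p) = above-threshold p

≤ᵇ-pred : ∀ x k → (x ≤ᵇ k) ≡ ((x ≤ᵇ suc k) ∧ not (x ≡ᵇ suc k))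
≤ᵇ-pred zero          k       = P.refl
≤ᵇ-pred (suc zero)    zero    = P.refl
≤ᵇ-pred (suc zero)    (suc k) = P.refl
≤ᵇ-pred (suc (suc x)) zero    = P.refl
≤ᵇ-pred (suc (suc x)) (suc k) = ≤ᵇ-pred (suc x) k

allB-pred : ∀ k S → allB (_≤ᵇ k) S ≡ (allB (_≤ᵇ suc k) S ∧ not (anyB (_≡ᵇ suc k) S))
allB-pred k []      = P.refl
allB-pred k (x ∷ S) =
  P.trans (P.cong₂ _∧_ (≤ᵇ-pred x k) (allB-pred k S))
          (interchange (x ≤ᵇ suc k) (x ≡ᵇ suc k) (allB (_≤ᵇ suc k) S) (anyB (_≡ᵇ suc k) S))
  where
  interchange : ∀ b e b′ e′ → ((b ∧ not e) ∧ (b′ ∧ not e′)) ≡ ((b ∧ b′) ∧ not (e ∨ e′))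
  interchange false e     b′    e′ = P.refl
  interchange true  false b′    e′ = P.refl
  interchange true  true  false e′ = P.refl
  interchange true  true  true  e′ = P.refl

data BlockOf (N : ℕ) : Block → Set where
  block : ∀ {x xs} → x ≤ N → All (_≤ N) xs → BlockOf N (x ∷ xs)

WellFormed : ℕ → Partition → Set
WellFormed N = All (BlockOf N)

blockOf-weaken : ∀ {N b} → BlockOf N b → BlockOf (suc N) b
blockOf-weaken (block x≤N xs≤N) = block (m≤n⇒m≤1+n x≤N) (All-map m≤n⇒m≤1+n xs≤N)

insertEach-wellFormed : ∀ {N p} → WellFormed (suc N) p →
  All (WellFormed (suc N)) (insertEach (suc N) p)
insertEach-wellFormed []                  = []
insertEach-wellFormed (block x≤ xs≤ ∷ wf) =
  (block ≤-refl (x≤ ∷ xs≤) ∷ wf) ∷ map⁺ (All-map (block x≤ xs≤ ∷_) (insertEach-wellFormed wf))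

partitions-wellFormed : ∀ N → All (WellFormed N) (partitions N)
partitions-wellFormed zero    = [] ∷ []
partitions-wellFormed (suc N) = concat⁺ (map⁺ (All-map extensions (partitions-wellFormed N)))
  where
  extensions : ∀ {p} → WellFormed N p →
    All (WellFormed (suc N)) (([ suc N ] ∷ p) ∷ insertEach (suc N) p)
  extensions wf = (block ≤-refl [] ∷ wf′) ∷ insertEach-wellFormed wf′
    where wf′ = All-map blockOf-weaken wf

-- Shapes of partitions relative to a threshold s

data Shape : Set where
  marked : Shape          -- a singleton block {i} with i > s
  plain  : ℕ → Shape      -- any other block, recorded by its size

data IsPlain : Shape → Set where
  plain : ∀ {j} → IsPlain (plain j)

enlarge : Shape → Shape
enlarge marked    = plain 2
enlarge (plain j) = plain (suc j)

-- All ways of enlarging exactly one block: the shape analogue of insertEach.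
enlargeOne : List Shape → List (List Shape)
enlargeOne []      = []
enlargeOne (σ ∷ l) = (enlarge σ ∷ l) ∷ map (σ ∷_) (enlargeOne l)

blockShape : ℕ → Block → Shape
blockShape s []          = plain 0
blockShape s (x ∷ [])    = if x ≤ᵇ s then plain 1 else marked
blockShape s (_ ∷ _ ∷ b) = plain (suc (suc (length b)))

shape : ℕ → Partition → List Shape
shape s = map (blockShape s)

blockShape-insert : ∀ s m {N b} → BlockOf N b → blockShape s (m ∷ b) ≡ enlarge (blockShape s b)
blockShape-insert s m {b = x ∷ []} (block _ _) with x ≤ᵇ s
... | true  = P.refl
... | false = P.refl
blockShape-insert s m {b = x ∷ y ∷ b} (block _ _) = P.refl

blockShape-new : ∀ {s N} → s ≤ N → blockShape s [ suc N ] ≡ marked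
blockShape-new s≤N rewrite above-threshold s≤N = P.refl

shape-plain : ∀ {s p} → WellFormed s p → All IsPlain (shape s p)
shape-plain []                              = []
shape-plain (block x≤s [] ∷ wf) rewrite below-threshold x≤s = plain ∷ shape-plain wf
shape-plain (block _ (_ ∷ _) ∷ wf)          = plain ∷ shape-plain wf

enlargeOne-plain : ∀ {l} → All IsPlain l → All (All IsPlain) (enlargeOne l)
enlargeOne-plain []           = []
enlargeOne-plain (plain ∷ ps) = (plain ∷ ps) ∷ map⁺ (All-map (plain ∷_) (enlargeOne-plain ps))

-- Finite sums and the binomial transform in a commutative ring

module Sums {c ℓ : Level} (R : CommutativeRing c ℓ) where
  open CommutativeRing R
  open Ring R
  open import Relation.Binary.Reasoning.Setoid setoid
  open import Tactic.RingSolver.NonReflective (fromCommutativeRing R (λ _ → nothing))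
  open import Algebra.Properties.Semiring.Mult semiring using (_×_; ×-congʳ; ×-congˡ; ×-homo-+; ×-comm-*)
  open import Algebra.Properties.Ring ring using (-0#≈0#; -‿+-comm; -‿involutive; -‿distribˡ-*)

  minus-zero : ∀ x → x - 0# ≈ x
  minus-zero x = trans (+-congˡ -0#≈0#) (+-identityʳ x)

  sub-cancel : ∀ x a z → x - (x + (- a) * z) ≈ a * z
  sub-cancel x a z = begin
    x - (x + - a * z)        ≈⟨ +-congˡ (sym (-‿+-comm x (- a * z))) ⟩
    x + (- x + - (- a * z))  ≈⟨ sym (+-assoc _ _ _) ⟩
    (x - x) + - (- a * z)    ≈⟨ +-congʳ (-‿inverseʳ x) ⟩
    0# + - (- a * z)         ≈⟨ +-identityˡ _ ⟩
    - (- a * z)              ≈⟨ -‿cong (sym (-‿distribˡ-* a z)) ⟩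
    - (- (a * z))            ≈⟨ -‿involutive _ ⟩
    a * z                    ∎

  sum-map : ∀ {X Z : Set} (f : Z → Carrier) (g : X → Z) L →
    sumR (map f (map g L)) ≡ sumR (map (λ x → f (g x)) L)
  sum-map f g []      = P.refl
  sum-map f g (x ∷ L) = P.cong (f (g x) +_) (sum-map f g L)

  sum-congᴬ : ∀ {X : Set} {Q : X → Set} {f g : X → Carrier} →
    (∀ {x} → Q x → f x ≈ g x) → ∀ {L} → All Q L → sumR (map f L) ≈ sumR (map g L)
  sum-congᴬ f≈g []       = refl
  sum-congᴬ f≈g (q ∷ qs) = +-cong (f≈g q) (sum-congᴬ f≈g qs)

  sum-cong : ∀ {X : Set} {f g : X → Carrier} → (∀ x → f x ≈ g x) → ∀ L →
    sumR (map f L) ≈ sumR (map g L)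
  sum-cong f≈g []      = refl
  sum-cong f≈g (x ∷ L) = +-cong (f≈g x) (sum-cong f≈g L)

  sum-++ : ∀ {X : Set} (f : X → Carrier) L L′ →
    sumR (map f (L ++ L′)) ≈ sumR (map f L) + sumR (map f L′)
  sum-++ f []      L′ = sym (+-identityˡ _)
  sum-++ f (x ∷ L) L′ = trans (+-congˡ (sum-++ f L L′)) (sym (+-assoc _ _ _))

  sum-concatMap : ∀ {X Z : Set} (f : Z → Carrier) (g : X → List Z) L →
    sumR (map f (concatMap g L)) ≈ sumR (map (λ x → sumR (map f (g x))) L)
  sum-concatMap f g []      = refl
  sum-concatMap f g (x ∷ L) = trans (sum-++ f (g x) _) (+-congˡ (sum-concatMap f g L))

  sum-+ : ∀ {X : Set} (f g : X → Carrier) L →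
    sumR (map (λ x → f x + g x) L) ≈ sumR (map f L) + sumR (map g L)
  sum-+ f g []      = sym (+-identityˡ 0#)
  sum-+ f g (x ∷ L) = trans (+-congˡ (sum-+ f g L))
    (solve 4 (λ a b u v → (a ⊕ b ⊕ (u ⊕ v)) ⊜ (a ⊕ u ⊕ (b ⊕ v))) refl (f x) (g x) _ _)

  sum-− : ∀ {X : Set} (f g : X → Carrier) L →
    sumR (map (λ x → f x - g x) L) ≈ sumR (map f L) - sumR (map g L)
  sum-− f g []      = sym (minus-zero 0#)
  sum-− f g (x ∷ L) = trans (+-congˡ (sum-− f g L))
    (solve 4 (λ a b u v → (a ⊕ ⊝ b ⊕ (u ⊕ ⊝ v)) ⊜ (a ⊕ u ⊕ ⊝ (b ⊕ v))) refl (f x) (g x) _ _)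

  sum-* : ∀ {X : Set} (a : Carrier) (f : X → Carrier) L →
    sumR (map (λ x → a * f x) L) ≈ a * sumR (map f L)
  sum-* a f []      = sym (zeroʳ a)
  sum-* a f (x ∷ L) = trans (+-congˡ (sum-* a f L)) (sym (distribˡ a _ _))

  sum-linear : ∀ {X : Set} (d : Carrier) {f g h : X → Carrier} →
    (∀ x → f x ≈ g x + d * h x) → ∀ L → sumR (map f L) ≈ sumR (map g L) + d * sumR (map h L)
  sum-linear d {g = g} {h} f≈ L =
    trans (sum-cong f≈ L) (trans (sum-+ g (λ x → d * h x) L) (+-congˡ (sum-* d h L)))

  sum-filter : ∀ {X : Set} (b : X → Bool) (f : X → Carrier) L →
    sumR (map f (filterB b L)) ≈ sumR (map (λ x → if b x then f x else 0#) L)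
  sum-filter b f []      = refl
  sum-filter b f (x ∷ L) with b x
  ... | true  = +-congˡ (sum-filter b f L)
  ... | false = trans (sum-filter b f L) (sym (+-identityˡ _))

  Σ< : ℕ → (ℕ → Carrier) → Carrier
  Σ< zero    g = 0#
  Σ< (suc n) g = g 0 + Σ< n (λ i → g (suc i))

  sum-applyUpTo : ∀ (h : ℕ → Carrier) (f : ℕ → ℕ) n →
    sumR (map h (applyUpTo f n)) ≡ Σ< n (λ i → h (f i))
  sum-applyUpTo h f zero    = P.refl
  sum-applyUpTo h f (suc n) = P.cong (h (f 0) +_) (sum-applyUpTo h (λ i → f (suc i)) n)

  Σ<-cong : ∀ n {g h : ℕ → Carrier} → (∀ i → i < n → g i ≈ h i) → Σ< n g ≈ Σ< n h
  Σ<-cong zero    g≈h = refl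
  Σ<-cong (suc n) g≈h = +-cong (g≈h 0 (s≤s z≤n)) (Σ<-cong n (λ i i<n → g≈h (suc i) (s≤s i<n)))

  Σ<-+ : ∀ n (g h : ℕ → Carrier) → Σ< n (λ i → g i + h i) ≈ Σ< n g + Σ< n h
  Σ<-+ zero    g h = sym (+-identityˡ 0#)
  Σ<-+ (suc n) g h = trans (+-congˡ (Σ<-+ n _ _))
    (solve 4 (λ a b u v → (a ⊕ b ⊕ (u ⊕ v)) ⊜ (a ⊕ u ⊕ (b ⊕ v))) refl (g 0) (h 0) _ _)

  Σ<-* : ∀ n (a : Carrier) (g : ℕ → Carrier) → Σ< n (λ i → a * g i) ≈ a * Σ< n g
  Σ<-* zero    a g = sym (zeroʳ a)
  Σ<-* (suc n) a g = trans (+-congˡ (Σ<-* n a _)) (sym (distribˡ a _ _))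

  Σ<-snoc : ∀ n (g : ℕ → Carrier) → Σ< (suc n) g ≈ Σ< n g + g n
  Σ<-snoc zero    g = +-comm _ _
  Σ<-snoc (suc n) g = trans (+-congˡ (Σ<-snoc n _)) (sym (+-assoc _ _ _))

  Σ<-zero : ∀ n (g : ℕ → Carrier) → (∀ i → g i ≈ 0#) → Σ< n g ≈ 0#
  Σ<-zero zero    g g≈0 = refl
  Σ<-zero (suc n) g g≈0 = trans (+-cong (g≈0 0) (Σ<-zero n _ (λ i → g≈0 (suc i)))) (+-identityˡ 0#)

  ·ℕ≡× : ∀ m x → m ·ℕ x ≡ m × x
  ·ℕ≡× zero    x = P.refl
  ·ℕ≡× (suc m) x = P.cong (x +_) (·ℕ≡× m x)

  ·ℕ-null : ∀ m {x} → x ≈ 0# → m ·ℕ x ≈ 0#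
  ·ℕ-null zero    x≈0 = refl
  ·ℕ-null (suc m) x≈0 = trans (+-cong x≈0 (·ℕ-null m x≈0)) (+-identityˡ 0#)

  -- The binomial transform, defined by Pascal's recursion; its closed form
  -- is  Binom d n f = Σ_a C(n,a) d^a f(n-a)  (Binom-closed below).

  Binom : Carrier → ℕ → (ℕ → Carrier) → Carrier
  Binom d zero    f = f 0
  Binom d (suc n) f = Binom d n (λ j → f (suc j)) + d * Binom d n f

  Binom-cong : ∀ d n {f g : ℕ → Carrier} → (∀ j → f j ≈ g j) → Binom d n f ≈ Binom d n g
  Binom-cong d zero    f≈g = f≈g 0
  Binom-cong d (suc n) f≈g =
    +-cong (Binom-cong d n (λ j → f≈g (suc j))) (*-congˡ (Binom-cong d n f≈g))

  Binom-zero : ∀ d n → Binom d n (λ _ → 0#) ≈ 0#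
  Binom-zero d zero    = refl
  Binom-zero d (suc n) =
    trans (+-cong (Binom-zero d n) (*-congˡ (Binom-zero d n))) (trans (+-identityˡ _) (zeroʳ d))

  Binom-linear : ∀ d n (a : Carrier) (f g : ℕ → Carrier) →
    Binom d n (λ j → f j + a * g j) ≈ Binom d n f + a * Binom d n g
  Binom-linear d zero    a f g = refl
  Binom-linear d (suc n) a f g =
    trans (+-cong (Binom-linear d n a _ _) (*-congˡ (Binom-linear d n a f g)))
      (solve 6 (λ a e x y u v → (x ⊕ a ⊗ y ⊕ e ⊗ (u ⊕ a ⊗ v)) ⊜ (x ⊕ e ⊗ u ⊕ a ⊗ (y ⊕ e ⊗ v)))
         refl a d _ _ _ _)

  Binom-+ : ∀ d n (f g : ℕ → Carrier) → Binom d n (λ j → f j + g j) ≈ Binom d n f + Binom d n g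
  Binom-+ d n f g = begin
    Binom d n (λ j → f j + g j)             ≈⟨ Binom-cong d n (λ j → +-congˡ (sym (*-identityˡ (g j)))) ⟩
    Binom d n (λ j → f j + 1# * g j)        ≈⟨ Binom-linear d n 1# f g ⟩
    Binom d n f + 1# * Binom d n g          ≈⟨ +-congˡ (*-identityˡ _) ⟩
    Binom d n f + Binom d n g               ∎

  Binom-sum : ∀ {X : Set} d n (f : X → ℕ → Carrier) L →
    sumR (map (λ x → Binom d n (f x)) L) ≈ Binom d n (λ j → sumR (map (λ x → f x j) L))
  Binom-sum d n f []      = sym (Binom-zero d n)
  Binom-sum d n f (x ∷ L) = trans (+-congˡ (Binom-sum d n f L)) (sym (Binom-+ d n _ _))

  Binom-0 : ∀ n (f : ℕ → Carrier) → Binom 0# n f ≈ f n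
  Binom-0 zero    f = refl
  Binom-0 (suc n) f = trans (+-cong (Binom-0 n _) (zeroˡ _)) (+-identityʳ _)

  binomialSum : Carrier → ℕ → (ℕ → Carrier) → Carrier
  binomialSum d n f = Σ< (suc n) (λ a → (n C a) × (d ^ℕ a * f (n ∸ℕ a)))

  pascal : ∀ d n f →
    binomialSum d (suc n) f ≈ binomialSum d n (λ j → f (suc j)) + d * binomialSum d n f
  pascal d n f = begin
      h₀ + Σ< (suc n) (λ b → (suc n C suc b) × (d ^ℕ suc b * f (n ∸ℕ b)))
    ≈⟨ +-congˡ (Σ<-cong (suc n) (λ b _ → split b)) ⟩
      h₀ + Σ< (suc n) (λ b → d * term b + q b)
    ≈⟨ +-congˡ (trans (Σ<-+ (suc n) (λ b → d * term b) q) (+-congʳ (Σ<-* (suc n) d term))) ⟩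
      h₀ + (d * binomialSum d n f + Σ< (suc n) q)
    ≈⟨ +-congˡ (+-congˡ (trans (Σ<-snoc n q) (trans (+-congˡ last-vanishes) (+-identityʳ _)))) ⟩
      h₀ + (d * binomialSum d n f + Σ< n q)
    ≈⟨ +-congˡ (+-congˡ (Σ<-cong n (λ b b<n → ×-congʳ (n C suc b)
         (*-congˡ (reflexive (P.cong f (+-∸-assoc 1 b<n))))))) ⟩
      h₀ + (d * binomialSum d n f + Σ< n q′)
    ≈⟨ solve 3 (λ a b c → (a ⊕ (b ⊕ c)) ⊜ (a ⊕ c ⊕ b)) refl h₀ _ _ ⟩
      binomialSum d n (λ j → f (suc j)) + d * binomialSum d n f
    ∎
    where
    h₀ = 1 × (1# * f (suc n))
    term : ℕ → Carrier
    term b = (n C b) × (d ^ℕ b * f (n ∸ℕ b))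
    q : ℕ → Carrier
    q b = (n C suc b) × (d ^ℕ suc b * f (n ∸ℕ b))
    q′ : ℕ → Carrier
    q′ b = (n C suc b) × (d ^ℕ suc b * f (suc (n ∸ℕ suc b)))
    last-vanishes : q n ≈ 0#
    last-vanishes = ×-congˡ (k>n⇒nCk≡0 {n} {suc n} (s≤s ≤-refl))
    split : ∀ b → (suc n C suc b) × (d ^ℕ suc b * f (n ∸ℕ b)) ≈ d * term b + q b
    split b = begin
        (suc n C suc b) × (d ^ℕ suc b * f (n ∸ℕ b))
      ≈⟨ ×-congˡ (P.sym (nCk+nC[k+1]≡[n+1]C[k+1] n b)) ⟩
        (n C b +ℕ n C suc b) × (d ^ℕ suc b * f (n ∸ℕ b))
      ≈⟨ ×-homo-+ _ (n C b) (n C suc b) ⟩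
        (n C b) × ((d * d ^ℕ b) * f (n ∸ℕ b)) + q b
      ≈⟨ +-congʳ (trans (×-congʳ (n C b) (*-assoc _ _ _)) (sym (×-comm-* (n C b) d _))) ⟩
        d * term b + q b
      ∎

  Binom-closed : ∀ d n f → Binom d n f ≈ binomialSum d n f
  Binom-closed d zero    f = sym (trans (+-identityʳ _) (trans (+-identityʳ _) (*-identityˡ _)))
  Binom-closed d (suc n) f =
    trans (+-cong (Binom-closed d n _) (*-congˡ (Binom-closed d n f))) (sym (pascal d n f))

-- Weighted sums over partitions, for weights t : ℕ → Carrier

module Weighted {c ℓ : Level} (R : CommutativeRing c ℓ) (t : ℕ → CommutativeRing.Carrier R) where
  open CommutativeRing R
  open Ring R
  open Sums R
  open import Relation.Binary.Reasoning.Setoid setoid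
  open import Tactic.RingSolver.NonReflective (fromCommutativeRing R (λ _ → nothing))
  open import Algebra.Properties.Semiring.Mult semiring using (_×_; ×-congʳ)

  W : Carrier → List Shape → Carrier
  W μ []             = 1#
  W μ (marked  ∷ l)  = μ * W μ l
  W μ (plain j ∷ l)  = t j * W μ l

  W-++ : ∀ μ l l′ → W μ (l ++ l′) ≈ W μ l * W μ l′
  W-++ μ []            l′ = sym (*-identityˡ _)
  W-++ μ (marked  ∷ l) l′ = trans (*-congˡ (W-++ μ l l′)) (sym (*-assoc _ _ _))
  W-++ μ (plain j ∷ l) l′ = trans (*-congˡ (W-++ μ l l′)) (sym (*-assoc _ _ _))

  W-plain : ∀ μ μ′ {l} → All IsPlain l → W μ l ≡ W μ′ l
  W-plain μ μ′ []                = P.refl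
  W-plain μ μ′ (plain {j} ∷ ps) = P.cong (t j *_) (W-plain μ μ′ ps)

  weight-shape : ∀ s q → weight t q ≡ W (t 1) (shape s q)
  weight-shape s []                  = P.refl
  weight-shape s ([] ∷ q)            = P.cong (t 0 *_) (weight-shape s q)
  weight-shape s ((x ∷ []) ∷ q) with x ≤ᵇ s
  ... | true  = P.cong (t 1 *_) (weight-shape s q)
  ... | false = P.cong (t 1 *_) (weight-shape s q)
  weight-shape s ((x ∷ y ∷ b) ∷ q)   = P.cong (t (suc (suc (length b))) *_) (weight-shape s q)

  *-if : ∀ b a w → a * (if b then w else 0#) ≈ (if b then a * w else 0#)
  *-if true  a w = refl
  *-if false a w = zeroʳ a

  W0-indicator : ∀ s q → W 0# (shape s q) ≈ (if allB (_≤ᵇ s) (singletons q) then weight t q else 0#)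
  W0-indicator s []                = refl
  W0-indicator s ([] ∷ q)          = trans (*-congˡ (W0-indicator s q)) (*-if _ (t 0) _)
  W0-indicator s ((x ∷ []) ∷ q) with x ≤ᵇ s
  ... | true  = trans (*-congˡ (W0-indicator s q)) (*-if _ (t 1) _)
  ... | false = zeroˡ _
  W0-indicator s ((x ∷ y ∷ b) ∷ q) = trans (*-congˡ (W0-indicator s q)) (*-if _ (t (suc (suc (length b)))) _)

  extend : Shape → (List Shape → Carrier) → List Shape → Carrier
  extend τ φ l = φ (τ ∷ l) + sumR (map φ (enlargeOne l))

  extendⁿ : Shape → ℕ → (List Shape → Carrier) → List Shape → Carrier
  extendⁿ τ zero    φ = φ
  extendⁿ τ (suc n) φ = extend τ (extendⁿ τ n φ)

  extend-cong : ∀ τ {φ ψ} → (∀ l → φ l ≈ ψ l) → ∀ l → extend τ φ l ≈ extend τ ψ l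
  extend-cong τ φ≈ψ l = +-cong (φ≈ψ _) (sum-cong φ≈ψ (enlargeOne l))

  extendⁿ-comm : ∀ τ n φ l → extendⁿ τ n (extend τ φ) l ≈ extend τ (extendⁿ τ n φ) l
  extendⁿ-comm τ zero    φ l = refl
  extendⁿ-comm τ (suc n) φ l = extend-cong τ (extendⁿ-comm τ n φ) l

  extendⁿ-plain-cong : ∀ j {φ ψ} → (∀ {l} → All IsPlain l → φ l ≈ ψ l) →
    ∀ {l} → All IsPlain l → extendⁿ (plain 1) j φ l ≈ extendⁿ (plain 1) j ψ l
  extendⁿ-plain-cong zero    φ≈ψ u = φ≈ψ u
  extendⁿ-plain-cong (suc j) φ≈ψ u =
    +-cong (extendⁿ-plain-cong j φ≈ψ (plain ∷ u))
           (sum-congᴬ (extendⁿ-plain-cong j φ≈ψ) (enlargeOne-plain u))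

  enlargeOne-++ : ∀ (φ : List Shape → Carrier) pre l →
    sumR (map φ (enlargeOne (pre ++ l)))
      ≈ sumR (map (λ q → φ (q ++ l)) (enlargeOne pre)) + sumR (map (λ r → φ (pre ++ r)) (enlargeOne l))
  enlargeOne-++ φ []        l = sym (+-identityˡ _)
  enlargeOne-++ φ (σ ∷ pre) l = begin
      φ (enlarge σ ∷ pre ++ l) + sumR (map φ (map (σ ∷_) (enlargeOne (pre ++ l))))
    ≡⟨ P.cong (φ (enlarge σ ∷ pre ++ l) +_) (sum-map φ (σ ∷_) (enlargeOne (pre ++ l))) ⟩
      φ (enlarge σ ∷ pre ++ l) + sumR (map (λ q → φ (σ ∷ q)) (enlargeOne (pre ++ l)))
    ≈⟨ +-congˡ (enlargeOne-++ (λ q → φ (σ ∷ q)) pre l) ⟩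
      φ (enlarge σ ∷ pre ++ l) + (left + right)
    ≈⟨ sym (+-assoc _ _ _) ⟩
      (φ (enlarge σ ∷ pre ++ l) + left) + right
    ≡⟨ P.cong (λ z → (φ (enlarge σ ∷ pre ++ l) + z) + right)
         (P.sym (sum-map (λ q → φ (q ++ l)) (σ ∷_) (enlargeOne pre))) ⟩
      (φ (enlarge σ ∷ pre ++ l) + sumR (map (λ q → φ (q ++ l)) (map (σ ∷_) (enlargeOne pre)))) + right
    ∎
    where
    left  = sumR (map (λ q → φ (σ ∷ q ++ l)) (enlargeOne pre))
    right = sumR (map (λ r → φ (σ ∷ pre ++ r)) (enlargeOne l))

  extend-around : ∀ τ φ pre x l → extend τ φ (pre ++ x ∷ l) ≈
    φ (τ ∷ pre ++ x ∷ l) + (sumR (map (λ q → φ (q ++ x ∷ l)) (enlargeOne pre))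
      + (φ (pre ++ enlarge x ∷ l) + sumR (map (λ r → φ (pre ++ x ∷ r)) (enlargeOne l))))
  extend-around τ φ pre x l = +-congˡ (trans (enlargeOne-++ φ pre (x ∷ l))
    (+-congˡ (+-congˡ (reflexive (sum-map (λ r → φ (pre ++ r)) (x ∷_) (enlargeOne l))))))

  insertEach-shape : ∀ s m (φ : List Shape → Carrier) {N p} → WellFormed N p →
    sumR (map (λ q → φ (shape s q)) (insertEach m p)) ≡ sumR (map φ (enlargeOne (shape s p)))
  insertEach-shape s m φ []                  = P.refl
  insertEach-shape s m φ {p = b ∷ p} (bb ∷ wf) =
    P.cong₂ _+_ (P.cong (λ σ → φ (σ ∷ shape s p)) (blockShape-insert s m bb))
      (P.trans (sum-map (λ q → φ (shape s q)) (b ∷_) (insertEach m p))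
        (P.trans (insertEach-shape s m (λ l → φ (blockShape s b ∷ l)) wf)
          (P.sym (sum-map φ (blockShape s b ∷_) (enlargeOne (shape s p))))))

  partitions-step : ∀ {s N} → s ≤ N → ∀ (φ : List Shape → Carrier) →
    sumR (map (λ q → φ (shape s q)) (partitions (suc N)))
      ≈ sumR (map (λ p → extend marked φ (shape s p)) (partitions N))
  partitions-step {s} {N} s≤N φ =
    trans (sum-concatMap (λ q → φ (shape s q)) _ (partitions N))
          (sum-congᴬ per-partition (partitions-wellFormed N))
    where
    per-partition : ∀ {p} → WellFormed N p →
      φ (shape s ([ suc N ] ∷ p)) + sumR (map (λ q → φ (shape s q)) (insertEach (suc N) p))
        ≈ extend marked φ (shape s p)
    per-partition wf = reflexive (P.cong₂ _+_
      (P.cong (λ σ → φ (σ ∷ shape s _)) (blockShape-new s≤N)) (insertEach-shape s (suc N) φ wf))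

  partitions-extend : ∀ s n (φ : List Shape → Carrier) →
    sumR (map (λ q → φ (shape s q)) (partitions (n +ℕ s)))
      ≈ sumR (map (λ p → extendⁿ marked n φ (shape s p)) (partitions s))
  partitions-extend s zero    φ = refl
  partitions-extend s (suc n) φ = trans (partitions-step (m≤n+m s n) φ)
    (trans (partitions-extend s n (extend marked φ))
           (sum-cong (λ p → extendⁿ-comm marked n φ (shape s p)) (partitions s)))

  -- Expanding the marked singletons

  -- φ is linear in each marked slot: a marked singleton counts as a plain
  -- singleton plus δ times its absence.
  Splits : Carrier → (List Shape → Carrier) → Set ℓ
  Splits δ φ = ∀ pre l → φ (pre ++ marked ∷ l) ≈ φ (pre ++ plain 1 ∷ l) + δ * φ (pre ++ l)

  W-splits : ∀ {μ δ} → μ ≈ t 1 + δ → Splits δ (W μ)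
  W-splits {μ} {δ} μ≈ pre l = begin
      W μ (pre ++ marked ∷ l)
    ≈⟨ W-++ μ pre (marked ∷ l) ⟩
      W μ pre * (μ * W μ l)
    ≈⟨ *-congˡ (*-congʳ μ≈) ⟩
      W μ pre * ((t 1 + δ) * W μ l)
    ≈⟨ solve 4 (λ p a d w → p ⊗ ((a ⊕ d) ⊗ w) ⊜ (p ⊗ (a ⊗ w) ⊕ d ⊗ (p ⊗ w))) refl (W μ pre) (t 1) δ (W μ l) ⟩
      W μ pre * (t 1 * W μ l) + δ * (W μ pre * W μ l)
    ≈⟨ sym (+-cong (W-++ μ pre (plain 1 ∷ l)) (*-congˡ (W-++ μ pre l))) ⟩
      W μ (pre ++ plain 1 ∷ l) + δ * W μ (pre ++ l)
    ∎

  -- Plain extension preserves splitting, since enlarge marked = enlarge (plain 1).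
  extend-splits : ∀ {δ φ} → Splits δ φ → Splits δ (extend (plain 1) φ)
  extend-splits {δ} {φ} split pre l = begin
      extend (plain 1) φ (pre ++ marked ∷ l)
    ≈⟨ extend-around (plain 1) φ pre marked l ⟩
      φ (plain 1 ∷ pre ++ marked ∷ l) + (sumR (map (λ q → φ (q ++ marked ∷ l)) (enlargeOne pre))
        + (g + sumR (map (λ r → φ (pre ++ marked ∷ r)) (enlargeOne l))))
    ≈⟨ +-cong (split (plain 1 ∷ pre) l)
         (+-cong (sum-linear δ (λ q → split q l) (enlargeOne pre))
                 (+-congˡ (sum-linear δ (λ r → split pre r) (enlargeOne l)))) ⟩
      (a₁ + δ * a₀) + ((b₁ + δ * b₀) + (g + (d₁ + δ * d₀)))
    ≈⟨ solve 8 (λ a₁ a₀ b₁ b₀ g d₁ d₀ δ → (a₁ ⊕ δ ⊗ a₀ ⊕ (b₁ ⊕ δ ⊗ b₀ ⊕ (g ⊕ (d₁ ⊕ δ ⊗ d₀))))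
                 ⊜ (a₁ ⊕ (b₁ ⊕ (g ⊕ d₁)) ⊕ δ ⊗ (a₀ ⊕ (b₀ ⊕ d₀)))) refl a₁ a₀ b₁ b₀ g d₁ d₀ δ ⟩
      (a₁ + (b₁ + (g + d₁))) + δ * (a₀ + (b₀ + d₀))
    ≈⟨ sym (+-cong (extend-around (plain 1) φ pre (plain 1) l) (*-congˡ (+-congˡ (enlargeOne-++ φ pre l)))) ⟩
      extend (plain 1) φ (pre ++ plain 1 ∷ l) + δ * extend (plain 1) φ (pre ++ l)
    ∎
    where
    g  = φ (pre ++ plain 2 ∷ l)
    a₁ = φ (plain 1 ∷ pre ++ plain 1 ∷ l)
    a₀ = φ (plain 1 ∷ pre ++ l)
    b₁ = sumR (map (λ q → φ (q ++ plain 1 ∷ l)) (enlargeOne pre))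
    b₀ = sumR (map (λ q → φ (q ++ l)) (enlargeOne pre))
    d₁ = sumR (map (λ r → φ (pre ++ plain 1 ∷ r)) (enlargeOne l))
    d₀ = sumR (map (λ r → φ (pre ++ r)) (enlargeOne l))

  extendⁿ-splits : ∀ {δ φ} → Splits δ φ → ∀ j → Splits δ (extendⁿ (plain 1) j φ)
  extendⁿ-splits split zero    = split
  extendⁿ-splits split (suc j) = extend-splits (extendⁿ-splits split j)

  -- Each of the n new elements either starts a marked singleton, expanded as
  -- plain singleton or δ, or enters a block: a binomial transform in δ.
  marking-expansion : ∀ {δ φ} → Splits δ φ → ∀ n l →
    extendⁿ marked n φ l ≈ Binom δ n (λ j → extendⁿ (plain 1) j φ l)
  marking-expansion split zero    l = refl
  marking-expansion {δ} {φ} split (suc n) l = begin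
      extendⁿ marked n φ (marked ∷ l) + sumR (map (extendⁿ marked n φ) (enlargeOne l))
    ≈⟨ +-cong (marking-expansion split n (marked ∷ l)) (sum-cong (marking-expansion split n) (enlargeOne l)) ⟩
      Binom δ n (λ j → G j (marked ∷ l)) + sumR (map (λ q → Binom δ n (λ j → G j q)) (enlargeOne l))
    ≈⟨ +-cong (Binom-cong δ n (λ j → extendⁿ-splits split j [] l)) (Binom-sum δ n (λ q j → G j q) (enlargeOne l)) ⟩
      Binom δ n (λ j → G j (plain 1 ∷ l) + δ * G j l) + Binom δ n (λ j → sumR (map (G j) (enlargeOne l)))
    ≈⟨ +-congʳ (Binom-linear δ n δ _ _) ⟩
      (Binom δ n (λ j → G j (plain 1 ∷ l)) + δ * Binom δ n (λ j → G j l)) + Binom δ n (λ j → sumR (map (G j) (enlargeOne l)))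
    ≈⟨ solve 4 (λ x y d z → (x ⊕ d ⊗ y ⊕ z) ⊜ (x ⊕ z ⊕ d ⊗ y)) refl _ _ δ _ ⟩
      (Binom δ n (λ j → G j (plain 1 ∷ l)) + Binom δ n (λ j → sumR (map (G j) (enlargeOne l)))) + δ * Binom δ n (λ j → G j l)
    ≈⟨ +-congʳ (sym (Binom-+ δ n _ _)) ⟩
      Binom δ n (λ j → G (suc j) l) + δ * Binom δ n (λ j → G j l)
    ∎
    where
    G : ℕ → List Shape → Carrier
    G j = extendⁿ (plain 1) j φ

  -- Bell polynomials and partitions avoiding singletons above a threshold

  -- Y_{j+s} via plain extensions of the partitions of [s]  (μ = t₁, δ = 0).
  Y-expansion : ∀ s j → Y t (j +ℕ s)
    ≈ sumR (map (λ p → extendⁿ (plain 1) j (W (t 1)) (shape s p)) (partitions s))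
  Y-expansion s j = begin
      Y t (j +ℕ s)
    ≡⟨ P.cong sumR (map-cong (weight-shape s) (partitions (j +ℕ s))) ⟩
      sumR (map (λ q → W (t 1) (shape s q)) (partitions (j +ℕ s)))
    ≈⟨ partitions-extend s j (W (t 1)) ⟩
      sumR (map (λ p → extendⁿ marked j (W (t 1)) (shape s p)) (partitions s))
    ≈⟨ sum-cong (λ p → trans (marking-expansion (W-splits (sym (+-identityʳ (t 1)))) j (shape s p))
                             (Binom-0 j _)) (partitions s) ⟩
      sumR (map (λ p → extendⁿ (plain 1) j (W (t 1)) (shape s p)) (partitions s))
    ∎

  -- Total weight of the partitions of [N] without singleton above s
  -- (see W0-indicator).
  Avoid : ℕ → ℕ → Carrier
  Avoid s N = sumR (map (λ q → W 0# (shape s q)) (partitions N))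

  -- P_s(n) = Σ_a C(n,a) (-t₁)^a Y_{n-a+s}   (μ = 0, δ = -t₁).
  Avoid-formula : ∀ s n → Avoid s (n +ℕ s) ≈ Binom (- t 1) n (λ j → Y t (j +ℕ s))
  Avoid-formula s n = begin
      Avoid s (n +ℕ s)
    ≈⟨ partitions-extend s n (W 0#) ⟩
      sumR (map (λ p → extendⁿ marked n (W 0#) (shape s p)) (partitions s))
    ≈⟨ sum-cong (λ p → marking-expansion (W-splits (sym (-‿inverseʳ (t 1)))) n (shape s p)) (partitions s) ⟩
      sumR (map (λ p → Binom (- t 1) n (λ j → extendⁿ (plain 1) j (W 0#) (shape s p))) (partitions s))
    ≈⟨ Binom-sum (- t 1) n (λ p j → extendⁿ (plain 1) j (W 0#) (shape s p)) (partitions s) ⟩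
      Binom (- t 1) n (λ j → sumR (map (λ p → extendⁿ (plain 1) j (W 0#) (shape s p)) (partitions s)))
    ≈⟨ Binom-cong (- t 1) n (λ j → trans (sum-congᴬ (λ wf → plain-part j (shape-plain wf)) (partitions-wellFormed s))
                                         (sym (Y-expansion s j))) ⟩
      Binom (- t 1) n (λ j → Y t (j +ℕ s))
    ∎
    where
    plain-part : ∀ j {l} → All IsPlain l → extendⁿ (plain 1) j (W 0#) l ≈ extendⁿ (plain 1) j (W (t 1)) l
    plain-part j = extendⁿ-plain-cong j (λ u → reflexive (W-plain 0# (t 1) u))

  -- A_{N,k} as a difference of avoiding sums

  if-∧-difference : ∀ e a w →
    (if e ∧ a then w else 0#) ≈ (if a then w else 0#) - (if a ∧ not e then w else 0#)
  if-∧-difference true  true  w = sym (minus-zero w)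
  if-∧-difference false true  w = sym (-‿inverseʳ w)
  if-∧-difference true  false w = sym (minus-zero 0#)
  if-∧-difference false false w = sym (minus-zero 0#)

  -- The largest singleton is {k+1}  iff  no singleton exceeds k+1 but one exceeds k.
  largest-singleton-indicator : ∀ k q →
    (if largestSingletonIs (suc k) q then weight t q else 0#) ≈ W 0# (shape (suc k) q) - W 0# (shape k q)
  largest-singleton-indicator k q = begin
      (if anyB (_≡ᵇ suc k) S ∧ allB (_≤ᵇ suc k) S then w else 0#)
    ≈⟨ if-∧-difference (anyB (_≡ᵇ suc k) S) (allB (_≤ᵇ suc k) S) w ⟩
      (if allB (_≤ᵇ suc k) S then w else 0#) - (if allB (_≤ᵇ suc k) S ∧ not (anyB (_≡ᵇ suc k) S) then w else 0#)
    ≡⟨ P.cong (λ b → (if allB (_≤ᵇ suc k) S then w else 0#) - (if b then w else 0#)) (P.sym (allB-pred k S)) ⟩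
      (if allB (_≤ᵇ suc k) S then w else 0#) - (if allB (_≤ᵇ k) S then w else 0#)
    ≈⟨ sym (+-cong (W0-indicator (suc k) q) (-‿cong (W0-indicator k q))) ⟩
      W 0# (shape (suc k) q) - W 0# (shape k q)
    ∎
    where
    S = singletons q
    w = weight t q

  A-difference : ∀ N k → A t N k ≈ Avoid (suc k) (suc N) - Avoid k (suc N)
  A-difference N k = begin
      sumR (map (weight t) (filterB (largestSingletonIs (suc k)) L))
    ≈⟨ sum-filter (largestSingletonIs (suc k)) (weight t) L ⟩
      sumR (map (λ q → if largestSingletonIs (suc k) q then weight t q else 0#) L)
    ≈⟨ sum-cong (largest-singleton-indicator k) L ⟩
      sumR (map (λ q → W 0# (shape (suc k) q) - W 0# (shape k q)) L)
    ≈⟨ sum-− _ _ L ⟩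
      Avoid (suc k) (suc N) - Avoid k (suc N)
    ∎
    where L = partitions (suc N)

  lhs-transform : ∀ n k → lhsA t n k ≈ t 1 * Binom (- t 1) n (λ j → Y t (j +ℕ k))
  lhs-transform n k = begin
      A t (n +ℕ k) k
    ≈⟨ A-difference (n +ℕ k) k ⟩
      Avoid (suc k) (suc (n +ℕ k)) - Avoid k (suc n +ℕ k)
    ≈⟨ +-cong shifted (-‿cong (Avoid-formula k (suc n))) ⟩
      X - (X + (- t 1) * Z)
    ≈⟨ sub-cancel X (t 1) Z ⟩
      t 1 * Z
    ∎
    where
    X = Binom (- t 1) n (λ j → Y t (suc (j +ℕ k)))
    Z = Binom (- t 1) n (λ j → Y t (j +ℕ k))
    shifted : Avoid (suc k) (suc (n +ℕ k)) ≈ X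
    shifted = begin
        Avoid (suc k) (suc (n +ℕ k))
      ≡⟨ P.cong (Avoid (suc k)) (P.sym (+-suc n k)) ⟩
        Avoid (suc k) (n +ℕ suc k)
      ≈⟨ Avoid-formula (suc k) n ⟩
        Binom (- t 1) n (λ j → Y t (j +ℕ suc k))
      ≈⟨ Binom-cong (- t 1) n (λ j → reflexive (P.cong (Y t) (+-suc j k))) ⟩
        X
      ∎

  -- Only the y⁰ coefficients of e^{-x t₁} survive in the product.
  rhs-closed : ∀ n k → rhsA t n k ≈ t 1 * binomialSum (- t 1) n (λ j → Y t (j +ℕ k))
  rhs-closed n k = *-congˡ (trans (reflexive (sum-applyUpTo _ (λ i → i) (suc n)))
                                  (Σ<-cong (suc n) (λ a _ → column a)))
    where
    column : ∀ a → Σ≤ k (λ b → (n C a) ·ℕ ((k C b) ·ℕ (expNegXt1 t a b * Yxy t (n ∸ℕ a) (k ∸ℕ b))))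
                   ≈ (n C a) × ((- t 1) ^ℕ a * Y t ((n ∸ℕ a) +ℕ k))
    column a = begin
        Σ≤ k (λ b → (n C a) ·ℕ ((k C b) ·ℕ (expNegXt1 t a b * Yxy t (n ∸ℕ a) (k ∸ℕ b))))
      ≡⟨ sum-applyUpTo _ (λ i → i) (suc k) ⟩
        (n C a) ·ℕ (y + 0#) + Σ< k (λ i → (n C a) ·ℕ ((k C suc i) ·ℕ (0# * Yxy t (n ∸ℕ a) (k ∸ℕ suc i))))
      ≈⟨ +-cong (trans (reflexive (·ℕ≡× (n C a) _)) (×-congʳ (n C a) (+-identityʳ y)))
                (Σ<-zero k _ (λ i → ·ℕ-null (n C a) (·ℕ-null (k C suc i) (zeroˡ _)))) ⟩
        (n C a) × y + 0#
      ≈⟨ +-identityʳ _ ⟩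
        (n C a) × y
      ∎
      where y = (- t 1) ^ℕ a * Y t ((n ∸ℕ a) +ℕ k)

lemma2p1 : ∀ {c ℓ} (R : CommutativeRing c ℓ) (t : ℕ → CommutativeRing.Carrier R) (n k : ℕ) →
    CommutativeRing._≈_ R (Ring.lhsA R t n k) (Ring.rhsA R t n k)
lemma2p1 R t n k = begin
    lhsA t n k                                            ≈⟨ lhs-transform n k ⟩
    t 1 * Binom (- t 1) n (λ j → Y t (j +ℕ k))            ≈⟨ *-congˡ (Binom-closed (- t 1) n _) ⟩
    t 1 * binomialSum (- t 1) n (λ j → Y t (j +ℕ k))      ≈⟨ sym (rhs-closed n k) ⟩
    rhsA t n k                                            ∎
  where
  open CommutativeRing R
  open Ring R
  open Sums R
  open Weighted R t
  open import Relation.Binary.Reasoning.Setoid setoid
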